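{- Let $k\ge 1$ and $a\ge 2$ be integers, let $d\in\mathbb{Z}\setminus\{0\}$, and let $B=(b_1,\dots,b_k)$ and $H=(h_1,\dots,h_k)$ be sequences of positive integers. Put $A=(a,\,h_1a+db_1,\,h_2a+db_2,\,\ldots,\,h_ka+db_k)$ and assume $\gcd(A)=1$; if $d<0$, assume moreover $h_ia+db_i>1$ for $1\le i\le k$. Let $p$ be a positive divisor of $a$. For $M\in\mathbb{N}$ define $$O_B^H(M)=\min\Big\{\sum_{i=1}^k h_ix_i \;\Big|\; \sum_{i=1}^k b_ix_i=M,\ x_i\in\mathbb{N}\Big\}$$ (with the value $+\infty$ if no such $x_i$ exist). For $0\le r\le \frac{a}{p}-1$ let $N_{dr,p}$ denote the least element of the numerical semigroup $\frac{\langle A\rangle}{p}$ that is congruent to $dr$ modulo $\frac{a}{p}$. Then $$N_{dr,p}=\min\left\{O_B^H(ma+rp)\cdot\frac{a}{p}+\left(\frac{ma}{p}+r\right)d \;\Big|\; m\in\mathbb{N}\right\}\qquad\text{for all } 0\le r\le \tfrac{a}{p}-1,$$ and the Apéry set of $\frac{a}{p}$ in $\frac{\langle A\rangle}{p}$ is $\{N_{dr,p}: 0\le r\le \frac{a}{p}-1\}$.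
   Context: $\mathbb{N}$ denotes the non-negative integers. For a sequence $A$ of positive integers, $\langle A\rangle$ is the set of all non-negative integer linear combinations of its entries; when $\gcd(A)=1$ it is a numerical semigroup (a submonoid of $\mathbb{N}$ with finite complement). For a positive integer $p$, $\frac{\langle A\rangle}{p}=\{x\in\mathbb{N}\mid px\in\langle A\rangle\}$, which is again a numerical semigroup. For a numerical semigroup $S$ and $w\in S\setminus\{0\}$, the Apéry set of $w$ in $S$ is $\{s\in S\mid s-w\notin S\}$; it consists of exactly $w$ elements, namely, for each residue class modulo $w$, the least element of $S$ in that class. Since $\gcd(a,d)=1$ (implied by $\gcd(A)=1$), the classes $dr$, $0\le r\le \frac{a}{p}-1$, run over all residues modulo $\frac{a}{p}$. -}

module Defs where

open import Data.Nat as ℕ using (ℕ; zero; suc; NonZero)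
open import Data.Integer as ℤ using (ℤ; +_)
open import Data.Integer.Divisibility as ℤD using ()
open import Data.Nat.Divisibility using (_∣_)
open import Data.Fin using (Fin; zero; suc)
open import Data.Product using (Σ; ∃; ∃-syntax; _×_; _,_)
open import Relation.Binary.PropositionalEquality using (_≡_)
open import Relation.Nullary using (¬_)

∑ : ∀ {k} → (Fin k → ℕ) → ℕ
∑ {zero} f = 0
∑ {suc k} f = f zero ℕ.+ ∑ (λ i → f (suc i))

∑ℤ : ∀ {k} → (Fin k → ℤ) → ℤ
∑ℤ {zero} f = + 0
∑ℤ {suc k} f = f zero ℤ.+ ∑ℤ (λ i → f (suc i))

IsLeastℕ : (ℕ → Set) → ℕ → Set
IsLeastℕ P n = P n × (∀ m → P m → n ℕ.≤ m)

IsLeastℤ : (ℤ → Set) → ℤ → Set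
IsLeastℤ P n = P n × (∀ m → P m → n ℤ.≤ m)

gen : ∀ {k} (a : ℕ) (d : ℤ) (b h : Fin k → ℕ) → Fin k → ℤ
gen a d b h i = + (h i ℕ.* a) ℤ.+ d ℤ.* + (b i)

GcdOne : ∀ {k} (a : ℕ) (d : ℤ) (b h : Fin k → ℕ) → Set
GcdOne a d b h = ∀ (e : ℕ) → e ∣ a → (∀ i → (+ e) ℤD.∣ gen a d b h i) → e ≡ 1

InSG : ∀ {k} (a : ℕ) (d : ℤ) (b h : Fin k → ℕ) → ℕ → Set
InSG {k} a d b h x =
  Σ ℕ λ c₀ → Σ (Fin k → ℕ) λ c →
    + x ≡ + (c₀ ℕ.* a) ℤ.+ ∑ℤ (λ i → + (c i) ℤ.* gen a d b h i)

InQuot : ∀ {k} (a : ℕ) (d : ℤ) (b h : Fin k → ℕ) (p : ℕ) → ℕ → Set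
InQuot a d b h p x = InSG a d b h (p ℕ.* x)

InApery : ∀ {k} (a : ℕ) (d : ℤ) (b h : Fin k → ℕ) (p w : ℕ) → ℕ → Set
InApery a d b h p w s =
  InQuot a d b h p s × ¬ (Σ ℕ λ t → InQuot a d b h p t × s ≡ t ℕ.+ w)

CongMod : ℕ → ℤ → ℕ → Set
CongMod q z n = (+ q) ℤD.∣ (+ n ℤ.- z)

IsN : ∀ {k} (a : ℕ) (d : ℤ) (b h : Fin k → ℕ) (p q r : ℕ) → ℕ → Set
IsN a d b h p q r = IsLeastℕ (λ n → InQuot a d b h p n × CongMod q (d ℤ.* + r) n)

-- v = O_B^H(M) (in particular, finite)
IsO : ∀ {k} (b h : Fin k → ℕ) (M : ℕ) → ℕ → Set
IsO {k} b h M = IsLeastℕ (λ v → Σ (Fin k → ℕ) λ x → ∑ (λ i → b i ℕ.* x i) ≡ M × ∑ (λ i → h i ℕ.* x i) ≡ v)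

-- the set { O_B^H(ma+rp)·q + (mq + r) d | m ∈ ℕ, O_B^H(ma+rp) finite }, q = a/p
RHSSet : ∀ {k} (a : ℕ) (d : ℤ) (b h : Fin k → ℕ) (p q r : ℕ) → ℤ → Set
RHSSet a d b h p q r z =
  Σ ℕ λ m → Σ ℕ λ v → IsO b h (m ℕ.* a ℕ.+ r ℕ.* p) v ×
    z ≡ + (v ℕ.* q) ℤ.+ + (m ℕ.* q ℕ.+ r) ℤ.* d

module Submission where

-- An element of ⟨A⟩ is c₀a + Σcᵢ(hᵢa + dbᵢ) = (c₀ + Σhᵢcᵢ)a + dΣbᵢcᵢ. As gcd(a, d) = 1, p n has
-- this form only if Σbᵢcᵢ = Mp, and then n = (c₀ + Σhᵢcᵢ)(a/p) + Md; the congruence n ≡ dr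
-- (mod a/p) forces M = m(a/p) + r. Conversely every x with Σbᵢxᵢ = ma + rp yields such an element
-- with c₀ = 0, so the least element of the class of dr is the minimum over m of
-- O(ma + rp)(a/p) + (m(a/p) + r)d. The class is nonempty because gcd(A) = 1 lets combinations of
-- the generators reach every residue modulo a, and every residue modulo a/p is some dr because d
-- is invertible modulo a/p; the Apéry set consists of the least elements of these classes.

open import Defs
open import Data.Empty using (⊥-elim)
open import Data.Fin using (Fin; zero; suc)
open import Data.Integer as ℤ using (ℤ; +_; -[1+_]; _+_; _-_; -_; _*_; _≤_; _<_)
open import Data.Integer.DivMod using (_%ℕ_; _/ℕ_; a≡a%ℕn+[a/ℕn]*n; n%ℕd<d)
import Data.Integer.Divisibility.Signed as ℤS
import Data.Integer.Properties as ℤP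
open import Data.Integer.Tactic.RingSolver using (solve-∀)
open import Data.Nat as ℕ using (ℕ; zero; suc; NonZero; _/_; z≤n; s≤s)
open import Data.Nat.DivMod using (m/n*n≡m)
open import Data.Nat.Divisibility using (_∣_; divides; ∣-refl; ∣-trans; ∣n⇒∣m*n; _∣?_)
open import Data.Nat.GCD using (gcd; gcd-GCD; module Bézout; gcd[m,n]∣m; gcd[m,n]∣n)
open import Data.Nat.Induction using (<-rec)
import Data.Nat.Properties as ℕP
import Data.Nat.Tactic.RingSolver as ℕ-Solver
open import Data.Product using (Σ; ∃; ∃₂; _×_; _,_; proj₁; proj₂)
open import Data.Vec.Functional using (_∷_; head; tail)
open import Function.Base using (_∘_)
open import Function.Bundles using (_⇔_; mk⇔)
open import Relation.Binary.Definitions using (_Respects_)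
open import Relation.Binary.PropositionalEquality
open import Relation.Nullary using (Dec; yes; no)
open import Relation.Nullary.Decidable using (map′; _×-dec_)
open import Relation.Unary using (Decidable)

least-exists : {P : ℕ → Set} → Decidable P → ∀ {n} → P n → Σ ℕ (IsLeastℕ P)
least-exists {P} P? {n} = <-rec (λ n → P n → Σ ℕ (IsLeastℕ P)) search n
  where
  search : ∀ n → (∀ {m} → m ℕ.< n → P m → Σ ℕ (IsLeastℕ P)) → P n → Σ ℕ (IsLeastℕ P)
  search n smaller pn with ℕP.anyUpTo? P? n
  ... | yes (m , m<n , pm) = smaller m<n pm
  ... | no none = n , pn , λ m pm → ℕP.≮⇒≥ (λ m<n → none (m , m<n , pm))

any-bounded? : ∀ {k} {Q : (Fin k → ℕ) → Set} → Q Respects _≗_ → Decidable Q →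
               ∀ B → Dec (∃ λ c → (∀ i → c i ℕ.≤ B) × Q c)
any-bounded? {zero} {Q} resp Q? B =
  map′ (λ q → none , (λ ()) , q) (λ (c , _ , q) → resp (λ ()) q) (Q? none)
  where
  none : Fin 0 → ℕ
  none ()
any-bounded? {suc k} {Q} resp Q? B = map′ to from (ℕP.anyUpTo? tail? (suc B))
  where
  Bounded : ∀ {n} → (Fin n → ℕ) → Set
  Bounded c = ∀ i → c i ℕ.≤ B
  tail? : Decidable (λ x → ∃ λ c → Bounded c × Q (x ∷ c))
  tail? x = any-bounded? (λ c≗c′ → resp λ { zero → refl ; (suc i) → c≗c′ i }) (Q? ∘ (x ∷_)) B
  to : (∃ λ x → x ℕ.< suc B × ∃ λ c → Bounded c × Q (x ∷ c)) → ∃ λ c → Bounded c × Q c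
  to (x , s≤s x≤B , c , c≤B , qc) = x ∷ c , (λ { zero → x≤B ; (suc i) → c≤B i }) , qc
  from : (∃ λ c → Bounded c × Q c) → ∃ λ x → x ℕ.< suc B × ∃ λ c → Bounded c × Q (x ∷ c)
  from (c , c≤B , qc) =
    head c , s≤s (c≤B zero) , tail c , c≤B ∘ suc , resp (λ { zero → refl ; (suc i) → refl }) qc

infixl 7 _·_

_·_ : ∀ {k} → (Fin k → ℕ) → (Fin k → ℕ) → ℕ
u · v = ∑ (λ i → u i ℕ.* v i)

∑-cong : ∀ {k} {f g : Fin k → ℕ} → f ≗ g → ∑ f ≡ ∑ g
∑-cong {zero} f≗g = refl
∑-cong {suc k} f≗g = cong₂ ℕ._+_ (f≗g zero) (∑-cong (f≗g ∘ suc))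

f≤∑f : ∀ {k} (f : Fin k → ℕ) i → f i ℕ.≤ ∑ f
f≤∑f f zero = ℕP.m≤m+n (f zero) _
f≤∑f f (suc i) = ℕP.≤-trans (f≤∑f (f ∘ suc) i) (ℕP.m≤n+m _ (f zero))

∑ℤ-cong : ∀ {k} {f g : Fin k → ℤ} → f ≗ g → ∑ℤ f ≡ ∑ℤ g
∑ℤ-cong {zero} f≗g = refl
∑ℤ-cong {suc k} f≗g = cong₂ _+_ (f≗g zero) (∑ℤ-cong (f≗g ∘ suc))

∑ℤ-+ : ∀ {k} (f g : Fin k → ℤ) → ∑ℤ (λ i → f i + g i) ≡ ∑ℤ f + ∑ℤ g
∑ℤ-+ {zero} f g = refl
∑ℤ-+ {suc k} f g = trans (cong (_+_ (f zero + g zero)) (∑ℤ-+ (f ∘ suc) (g ∘ suc)))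
                         (shuffle (f zero) (g zero) (∑ℤ (f ∘ suc)) (∑ℤ (g ∘ suc)))
  where
  shuffle : ∀ x y u v → x + y + (u + v) ≡ x + u + (y + v)
  shuffle = solve-∀

∑ℤ-* : ∀ {k} s (f : Fin k → ℤ) → ∑ℤ (λ i → s * f i) ≡ s * ∑ℤ f
∑ℤ-* {zero} s f = sym (ℤP.*-zeroʳ s)
∑ℤ-* {suc k} s f =
  trans (cong (_+_ (s * f zero)) (∑ℤ-* s (f ∘ suc))) (sym (ℤP.*-distribˡ-+ s _ _))

pos-· : ∀ {k} (u v : Fin k → ℕ) → + (u · v) ≡ ∑ℤ (λ i → + u i * + v i)
pos-· {zero} u v = refl
pos-· {suc k} u v = begin
  + (u zero ℕ.* v zero ℕ.+ tail u · tail v)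
    ≡⟨ ℤP.pos-+ (u zero ℕ.* v zero) (tail u · tail v) ⟩
  + (u zero ℕ.* v zero) + + (tail u · tail v)
    ≡⟨ cong₂ _+_ (ℤP.pos-* (u zero) (v zero)) (pos-· (tail u) (tail v)) ⟩
  + u zero * + v zero + ∑ℤ (λ i → + u (suc i) * + v (suc i))
    ∎
  where open ≡-Reasoning

pos-+* : ∀ x y z → + (x ℕ.+ y ℕ.* z) ≡ + x + + y * + z
pos-+* x y z = trans (ℤP.pos-+ x (y ℕ.* z)) (cong (_+_ (+ x)) (ℤP.pos-* y z))

gcd-bezout : ∀ m n → ∃₂ λ x y → + gcd m n ≡ x * + m + y * + n
gcd-bezout m n = from-identity (Bézout.identity (gcd-GCD m n))
  where
  open ≡-Reasoning
  G = gcd m n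
  lift : ∀ x y m′ n′ → G ℕ.+ y ℕ.* n′ ≡ x ℕ.* m′ → + G + + y * + n′ ≡ + x * + m′
  lift x y m′ n′ eq = trans (sym (pos-+* G y n′)) (trans (cong +_ eq) (ℤP.pos-* x m′))
  cancelʳ : ∀ g y n → g ≡ g + y * n + (- y) * n
  cancelʳ = solve-∀
  cancelˡ : ∀ g x m → g ≡ (- x) * m + (g + x * m)
  cancelˡ = solve-∀
  from-identity : Bézout.Identity G m n → ∃₂ λ x y → + G ≡ x * + m + y * + n
  from-identity (Bézout.+- x y eq) = + x , (- + y) , (begin
    + G                               ≡⟨ cancelʳ (+ G) (+ y) (+ n) ⟩
    + G + + y * + n + (- + y) * + n   ≡⟨ cong (λ z → z + (- + y) * + n) (lift x y m n eq) ⟩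
    + x * + m + (- + y) * + n         ∎)
  from-identity (Bézout.-+ x y eq) = (- + x) , + y , (begin
    + G                               ≡⟨ cancelˡ (+ G) (+ x) (+ m) ⟩
    (- + x) * + m + (+ G + + x * + m) ≡⟨ cong (_+_ ((- + x) * + m)) (lift y x n m eq) ⟩
    (- + x) * + m + + y * + n         ∎)

common-divisor-combination : ∀ {k} a (g : Fin k → ℕ) →
  ∃ λ e → e ∣ a × (∀ i → e ∣ g i) ×
    Σ ℤ λ u₀ → Σ (Fin k → ℤ) λ u → + e ≡ u₀ * + a + ∑ℤ (λ i → u i * + g i)
common-divisor-combination {zero} a g =
  a , ∣-refl , (λ ()) , + 1 , (λ ()) , sym (trans (ℤP.+-identityʳ (+ 1 * + a)) (ℤP.*-identityˡ (+ a)))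
common-divisor-combination {suc k} a g
  with common-divisor-combination a (tail g)
... | e , e∣a , e∣g , u₀ , u , e≡ with gcd-bezout e (head g)
... | x , y , gcd≡ =
  gcd e (head g) , ∣-trans (gcd[m,n]∣m e _) e∣a ,
  (λ { zero → gcd[m,n]∣n e _ ; (suc i) → ∣-trans (gcd[m,n]∣m e _) (e∣g i) }) ,
  x * u₀ , y ∷ (λ i → x * u i) , (begin
    + gcd e (head g)                        ≡⟨ gcd≡ ⟩
    x * + e + y * + head g                  ≡⟨ cong (λ z → x * z + y * + head g) e≡ ⟩
    x * (u₀ * + a + U) + y * + head g       ≡⟨ regroup x u₀ (+ a) U (y * + head g) ⟩
    x * u₀ * + a + (y * + head g + x * U)   ≡⟨ cong (λ z → x * u₀ * + a + (y * + head g + z)) scaled ⟨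
    x * u₀ * + a + (y * + head g + ∑ℤ (λ i → x * u i * + g (suc i))) ∎)
  where
  open ≡-Reasoning
  U = ∑ℤ (λ i → u i * + g (suc i))
  regroup : ∀ x u₀ a U Y → x * (u₀ * a + U) + Y ≡ x * u₀ * a + (Y + x * U)
  regroup = solve-∀
  scaled : ∑ℤ (λ i → x * u i * + g (suc i)) ≡ x * U
  scaled = trans (∑ℤ-cong (λ i → ℤP.*-assoc x (u i) (+ g (suc i)))) (∑ℤ-* x (λ i → u i * + g (suc i)))

bezout-cancel : ∀ {A D e t} u v → u * A + v * D ≡ + 1 → e ℤS.∣ A → e ℤS.∣ D * t → e ℤS.∣ t
bezout-cancel {A} {D} {e} {t} u v uA+vD≡1 e∣A e∣Dt =
  subst (e ℤS.∣_) t≡ (ℤS.∣m∣n⇒∣m+n (ℤS.∣n⇒∣m*n (u * t) e∣A) (ℤS.∣n⇒∣m*n v e∣Dt))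
  where
  open ≡-Reasoning
  regroup : ∀ u t A v D → u * t * A + v * (D * t) ≡ (u * A + v * D) * t
  regroup = solve-∀
  t≡ : u * t * A + v * (D * t) ≡ t
  t≡ = begin
    u * t * A + v * (D * t) ≡⟨ regroup u t A v D ⟩
    (u * A + v * D) * t     ≡⟨ cong (_* t) uA+vD≡1 ⟩
    + 1 * t                 ≡⟨ ℤP.*-identityˡ t ⟩
    t                       ∎

residue-of-multiple : ∀ {q M r} → r ℕ.< q → (+ q) ℤS.∣ (+ M - + r) → ∃ λ m → M ≡ m ℕ.* q ℕ.+ r
residue-of-multiple {q} {M} {r} r<q (ℤS.divides t M-r≡tq) = from-quotient t M≡tq+r
  where
  shift : ∀ M R → M ≡ (M - R) + R
  shift = solve-∀
  M≡tq+r : + M ≡ t * + q + + r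
  M≡tq+r = trans (shift (+ M) (+ r)) (cong (_+ + r) M-r≡tq)
  from-quotient : ∀ t → + M ≡ t * + q + + r → ∃ λ m → M ≡ m ℕ.* q ℕ.+ r
  from-quotient (+ m) eq =
    m , ℤP.+-injective (trans eq (sym (trans (ℤP.pos-+ (m ℕ.* q) r) (cong (_+ + r) (ℤP.pos-* m q)))))
  from-quotient -[1+ n ] eq = ⊥-elim (ℕP.<⇒≱ r<q (begin
    q                    ≤⟨ ℕP.m≤n*m q (suc n) ⟩
    suc n ℕ.* q          ≤⟨ ℕP.m≤n+m _ M ⟩
    M ℕ.+ suc n ℕ.* q    ≡⟨ ℤP.+-injective M+sn*q≡r ⟩
    r                    ∎))
    where
    open ℕP.≤-Reasoning
    cancel : ∀ T Q R → (- T) * Q + R + T * Q ≡ R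
    cancel = solve-∀
    M+sn*q≡r : + (M ℕ.+ suc n ℕ.* q) ≡ + r
    M+sn*q≡r = trans (pos-+* M (suc n) q)
                     (trans (cong (_+ + suc n * + q) eq) (cancel (+ suc n) (+ q) (+ r)))

congruent-gap : ∀ {q z m n} → CongMod q z m → CongMod q z n → m ℕ.≤ n →
                ∃ λ j → n ≡ m ℕ.+ j ℕ.* q
congruent-gap {q} {z} {m} {n} m≡z n≡z m≤n = gap q∣n∸m
  where
  telescope : ∀ N M Z → (N - Z) - (M - Z) ≡ N - M
  telescope = solve-∀
  difference : (+ n - z) - (+ m - z) ≡ + (n ℕ.∸ m)
  difference = trans (telescope (+ n) (+ m) z) (trans (ℤP.m-n≡m⊖n n m) (ℤP.⊖-≥ m≤n))
  q∣n∸m : q ∣ n ℕ.∸ m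
  q∣n∸m = ℤS.∣⇒∣ᵤ (subst (+ q ℤS.∣_) difference
    (ℤS.∣m∣n⇒∣m-n (ℤS.∣ᵤ⇒∣ {+ q} {+ n - z} n≡z) (ℤS.∣ᵤ⇒∣ {+ q} {+ m - z} m≡z)))
  gap : q ∣ n ℕ.∸ m → ∃ λ j → n ≡ m ℕ.+ j ℕ.* q
  gap (divides j n∸m≡jq) = j , trans (sym (ℕP.m+[n∸m]≡n m≤n)) (cong (m ℕ.+_) n∸m≡jq)

CongMod-+q⇒CongMod : ∀ {q z n} → CongMod q z (n ℕ.+ q) → CongMod q z n
CongMod-+q⇒CongMod {q} {z} {n} n+q≡z = ℤS.∣⇒∣ᵤ (subst (+ q ℤS.∣_) shifted
  (ℤS.∣m∣n⇒∣m-n (ℤS.∣ᵤ⇒∣ {+ q} {+ (n ℕ.+ q) - z} n+q≡z) (ℤS.∣-refl {+ q})))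
  where
  cancel : ∀ N Q Z → (N + Q - Z) - Q ≡ N - Z
  cancel = solve-∀
  shifted : (+ (n ℕ.+ q) - z) - + q ≡ + n - z
  shifted = trans (cong (λ x → (x - z) - + q) (ℤP.pos-+ n q)) (cancel (+ n) (+ q) z)

exact-quotient : ∀ p .{{_ : NonZero p}} z y → + p * z ≡ + y → ∃ λ n → + n ≡ z × p ℕ.* n ≡ y
exact-quotient p (+ n) y pn≡y = n , refl , ℤP.+-injective (trans (ℤP.pos-* p n) pn≡y)
exact-quotient (suc p) -[1+ n ] y ()

combination-residue : ∀ {k} a .{{_ : NonZero a}} (g : Fin k → ℕ) u₀ (u : Fin k → ℤ) →
  + 1 ≡ u₀ * + a + ∑ℤ (λ i → u i * + g i) →
  ∀ t → ∃ λ (c : Fin k → ℕ) → ∃ λ w → + (c · g) ≡ t + w * + a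
combination-residue a g u₀ u 1≡ t = c , - (t * u₀) - W , (begin
  + (c · g)                                     ≡⟨ pos-· c g ⟩
  ∑ℤ (λ i → + c i * + g i)                      ≡⟨ ∑ℤ-cong termwise ⟩
  ∑ℤ (λ i → t * (u i * + g i) + (- + a) * (quot i * + g i))
    ≡⟨ ∑ℤ-+ (λ i → t * (u i * + g i)) (λ i → (- + a) * (quot i * + g i)) ⟩
  ∑ℤ (λ i → t * (u i * + g i)) + ∑ℤ (λ i → (- + a) * (quot i * + g i))
    ≡⟨ cong₂ _+_ (∑ℤ-* t (λ i → u i * + g i)) (∑ℤ-* (- + a) (λ i → quot i * + g i)) ⟩
  t * U + (- + a) * W                           ≡⟨ regroup t U u₀ (+ a) W ⟩
  t * (u₀ * + a + U) + (- (t * u₀) - W) * + a   ≡⟨ cong (λ x → t * x + (- (t * u₀) - W) * + a) 1≡ ⟨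
  t * + 1 + (- (t * u₀) - W) * + a              ≡⟨ cong (_+ (- (t * u₀) - W) * + a) (ℤP.*-identityʳ t) ⟩
  t + (- (t * u₀) - W) * + a                    ∎)
  where
  open ≡-Reasoning
  c : Fin _ → ℕ
  c i = (t * u i) %ℕ a
  quot : Fin _ → ℤ
  quot i = (t * u i) /ℕ a
  U = ∑ℤ (λ i → u i * + g i)
  W = ∑ℤ (λ i → quot i * + g i)
  expand : ∀ C Q A G → C * G ≡ (C + Q * A) * G + (- A) * (Q * G)
  expand = solve-∀
  termwise : ∀ i → + c i * + g i ≡ t * (u i * + g i) + (- + a) * (quot i * + g i)
  termwise i = begin
    + c i * + g i
      ≡⟨ expand (+ c i) (quot i) (+ a) (+ g i) ⟩
    (+ c i + quot i * + a) * + g i + (- + a) * (quot i * + g i)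
      ≡⟨ cong (λ x → x * + g i + (- + a) * (quot i * + g i)) (a≡a%ℕn+[a/ℕn]*n (t * u i) a) ⟨
    t * u i * + g i + (- + a) * (quot i * + g i)
      ≡⟨ cong (_+ (- + a) * (quot i * + g i)) (ℤP.*-assoc t (u i) (+ g i)) ⟩
    t * (u i * + g i) + (- + a) * (quot i * + g i)
      ∎
  regroup : ∀ t U u₀ A W → t * U + (- A) * W ≡ t * (u₀ * A + U) + (- (t * u₀) - W) * A
  regroup = solve-∀

abs-multiple : ∀ i → ∃ λ s → + ℤ.∣ i ∣ ≡ s * i
abs-multiple (+ n) = + 1 , sym (ℤP.*-identityˡ (+ n))
abs-multiple -[1+ n ] = ℤ.-1ℤ , sym (ℤP.-1*i≡-i -[1+ n ])

gen-positive : ∀ {k a d} {b h : Fin k → ℕ} → d ≢ + 0 → (∀ i → 0 ℕ.< b i) →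
               (d < + 0 → ∀ i → + 1 < gen a d b h i) → ∀ i → + 0 < gen a d b h i
gen-positive {d = + zero} d≢0 _ _ i = ⊥-elim (d≢0 refl)
gen-positive {a = a} {+ suc n} {b} {h} _ b>0 _ i = subst (+ 0 <_) (pos-+* (h i ℕ.* a) (suc n) (b i))
  (ℤ.+<+ (ℕP.<-≤-trans (b>0 i) (ℕP.≤-trans (ℕP.m≤n*m (b i) (suc n)) (ℕP.m≤n+m _ (h i ℕ.* a)))))
gen-positive {d = -[1+ n ]} _ _ d<0⇒gen>1 i = ℤP.<-trans (ℤ.+<+ ℕ.z<s) (d<0⇒gen>1 ℤ.-<+ i)

module QuotientSemigroup {k} (a : ℕ) (d : ℤ) (b h : Fin k → ℕ) (p : ℕ) .{{_ : NonZero p}}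
  .{{_ : NonZero a}} (p∣a : p ∣ a) (gen>0 : ∀ i → + 0 < gen a d b h i) (gcd≡1 : GcdOne a d b h)
  where

  q : ℕ
  q = a / p

  q*p≡a : q ℕ.* p ≡ a
  q*p≡a = m/n*n≡m p∣a

  q∣a : q ∣ a
  q∣a = divides p (trans (sym q*p≡a) (ℕP.*-comm q p))

  +a≡+q*+p : + a ≡ + q * + p
  +a≡+q*+p = trans (cong +_ (sym q*p≡a)) (ℤP.pos-* q p)

  instance
    q≢0 : NonZero q
    q≢0 = ℕ.≢-nonZero λ q≡0 → ℕ.≢-nonZero⁻¹ a (trans (sym q*p≡a) (cong (ℕ._* p) q≡0))

  g : Fin k → ℕ
  g i = ℤ.∣ gen a d b h i ∣

  +g≡gen : ∀ i → + g i ≡ gen a d b h i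
  +g≡gen i = ℤP.0≤i⇒+∣i∣≡i (ℤP.<⇒≤ (gen>0 i))

  g>0 : ∀ i → 0 ℕ.< g i
  g>0 i = ℤP.drop‿+<+ (subst (+ 0 <_) (sym (+g≡gen i)) (gen>0 i))

  a-d-bezout : ∃₂ λ u v → u * + a + v * d ≡ + 1
  a-d-bezout with gcd-bezout a ℤ.∣ d ∣ | abs-multiple d
  ... | x , y , gcd≡ | s , ∣d∣≡sd = x , y * s , (begin
    x * + a + y * s * d
      ≡⟨ cong (_+_ (x * + a)) (trans (ℤP.*-assoc y s d) (cong (y *_) (sym ∣d∣≡sd))) ⟩
    x * + a + y * + ℤ.∣ d ∣   ≡⟨ gcd≡ ⟨
    + gcd a ℤ.∣ d ∣           ≡⟨ cong +_ coprime ⟩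
    + 1                       ∎)
    where
    open ≡-Reasoning
    e = gcd a ℤ.∣ d ∣
    coprime : e ≡ 1
    coprime = gcd≡1 e (gcd[m,n]∣m a _) λ i →
      ℤS.∣⇒∣ᵤ (ℤS.∣m∣n⇒∣m+n (ℤS.∣ᵤ⇒∣ {+ e} {+ (h i ℕ.* a)} (∣n⇒∣m*n (h i) (gcd[m,n]∣m a _)))
                            (ℤS.∣m⇒∣m*n (+ b i) (ℤS.∣ᵤ⇒∣ {+ e} {d} (gcd[m,n]∣n a _))))

  d-cancel : ∀ {e t} → e ∣ a → + e ℤS.∣ d * t → + e ℤS.∣ t
  d-cancel {e} e∣a with a-d-bezout
  ... | u , v , ua+vd≡1 = bezout-cancel u v ua+vd≡1 (ℤS.∣ᵤ⇒∣ {+ e} {+ a} e∣a)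

  residue : ∀ s → ∃ λ r → r ℕ.< q × CongMod q (d * + r) s
  residue s with a-d-bezout
  ... | u , v , ua+vd≡1 =
    r , n%ℕd<d (v * + s) q , ℤS.∣⇒∣ᵤ (ℤS.divides (u * + p * + s + d * t) (begin
      + s - d * + r
        ≡⟨ cong (λ x → x - d * + r) (ℤP.*-identityˡ (+ s)) ⟨
      + 1 * + s - d * + r
        ≡⟨ cong (λ x → x * + s - d * + r) ua+vd≡1 ⟨
      (u * + a + v * d) * + s - d * + r
        ≡⟨ cong (λ x → (u * x + v * d) * + s - d * + r) +a≡+q*+p ⟩
      (u * (+ q * + p) + v * d) * + s - d * + r
        ≡⟨ expand u (+ q) (+ p) v d (+ s) (+ r) ⟩
      u * + p * + s * + q + d * (v * + s) - d * + r
        ≡⟨ cong (λ x → u * + p * + s * + q + d * x - d * + r) (a≡a%ℕn+[a/ℕn]*n (v * + s) q) ⟩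
      u * + p * + s * + q + d * (+ r + t * + q) - d * + r
        ≡⟨ collect u (+ p) (+ s) (+ q) d (+ r) t ⟩
      (u * + p * + s + d * t) * + q
        ∎))
    where
    open ≡-Reasoning
    r = (v * + s) %ℕ q
    t = (v * + s) /ℕ q
    expand : ∀ u Q P v D S R →
             (u * (Q * P) + v * D) * S - D * R ≡ u * P * S * Q + D * (v * S) - D * R
    expand = solve-∀
    collect : ∀ u P S Q D R t → u * P * S * Q + D * (R + t * Q) - D * R ≡ (u * P * S + D * t) * Q
    collect = solve-∀

  Generated : ℕ → Set
  Generated y = Σ ℕ λ c₀ → Σ (Fin k → ℕ) λ c → y ≡ c₀ ℕ.* a ℕ.+ c · g

  ∑ℤ-gen : ∀ c → ∑ℤ (λ i → + c i * gen a d b h i) ≡ + (c · g)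
  ∑ℤ-gen c = trans (∑ℤ-cong (λ i → cong (+ c i *_) (sym (+g≡gen i)))) (sym (pos-· c g))

  InSG⇒Generated : ∀ {y} → InSG a d b h y → Generated y
  InSG⇒Generated {y} (c₀ , c , y≡) = c₀ , c , ℤP.+-injective (begin
    + y                                             ≡⟨ y≡ ⟩
    + (c₀ ℕ.* a) + ∑ℤ (λ i → + c i * gen a d b h i) ≡⟨ cong (_+_ (+ (c₀ ℕ.* a))) (∑ℤ-gen c) ⟩
    + (c₀ ℕ.* a) + + (c · g)                        ≡⟨ ℤP.pos-+ (c₀ ℕ.* a) (c · g) ⟨
    + (c₀ ℕ.* a ℕ.+ c · g)                          ∎)
    where open ≡-Reasoning

  Generated⇒InSG : ∀ {y} → Generated y → InSG a d b h y
  Generated⇒InSG {y} (c₀ , c , y≡) = c₀ , c , (begin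
    + y                                             ≡⟨ cong +_ y≡ ⟩
    + (c₀ ℕ.* a ℕ.+ c · g)                          ≡⟨ ℤP.pos-+ (c₀ ℕ.* a) (c · g) ⟩
    + (c₀ ℕ.* a) + + (c · g)                        ≡⟨ cong (_+_ (+ (c₀ ℕ.* a))) (∑ℤ-gen c) ⟨
    + (c₀ ℕ.* a) + ∑ℤ (λ i → + c i * gen a d b h i) ∎)
    where open ≡-Reasoning

  Generated? : Decidable Generated
  Generated? y =
    map′ from-search to-search (any-bounded? respects (λ c → y ℕ.≟ head c ℕ.* a ℕ.+ tail c · g) y)
    where
    Coefficients : (Fin (suc k) → ℕ) → Set
    Coefficients c = y ≡ head c ℕ.* a ℕ.+ tail c · g
    respects : Coefficients Respects _≗_
    respects c≗c′ y≡ =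
      trans y≡ (cong₂ (λ x z → x ℕ.* a ℕ.+ z) (c≗c′ zero) (∑-cong λ i → cong (ℕ._* g i) (c≗c′ (suc i))))
    from-search : (∃ λ c → (∀ i → c i ℕ.≤ y) × Coefficients c) → Generated y
    from-search (c , _ , y≡) = head c , tail c , y≡
    to-search : Generated y → ∃ λ c → (∀ i → c i ℕ.≤ y) × Coefficients c
    to-search (c₀ , c , y≡) = c₀ ∷ c , bound , y≡
      where
      open ℕP.≤-Reasoning
      bound : ∀ i → (c₀ ∷ c) i ℕ.≤ y
      bound zero = begin
        c₀                       ≤⟨ ℕP.m≤m*n c₀ a ⟩
        c₀ ℕ.* a                 ≤⟨ ℕP.m≤m+n _ (c · g) ⟩
        c₀ ℕ.* a ℕ.+ c · g       ≡⟨ y≡ ⟨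
        y                        ∎
      bound (suc i) = begin
        c i                      ≤⟨ ℕP.m≤m*n (c i) (g i) {{ℕ.>-nonZero (g>0 i)}} ⟩
        c i ℕ.* g i              ≤⟨ f≤∑f (λ j → c j ℕ.* g j) i ⟩
        c · g                    ≤⟨ ℕP.m≤n+m (c · g) (c₀ ℕ.* a) ⟩
        c₀ ℕ.* a ℕ.+ c · g       ≡⟨ y≡ ⟨
        y                        ∎

  InQuot? : Decidable (InQuot a d b h p)
  InQuot? n = map′ Generated⇒InSG InSG⇒Generated (Generated? (p ℕ.* n))

  InClass : ℕ → ℕ → Set
  InClass r n = InQuot a d b h p n × CongMod q (d * + r) n

  InClass? : ∀ r → Decidable (InClass r)
  InClass? r n = InQuot? n ×-dec (q ∣? ℤ.∣ + n - d * + r ∣)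

  gen-combination : ∀ c → + (c · g) ≡ + a * + (h · c) + d * + (b · c)
  gen-combination c = begin
    + (c · g)
      ≡⟨ ∑ℤ-gen c ⟨
    ∑ℤ (λ i → + c i * gen a d b h i)
      ≡⟨ ∑ℤ-cong termwise ⟩
    ∑ℤ (λ i → + a * (+ h i * + c i) + d * (+ b i * + c i))
      ≡⟨ ∑ℤ-+ (λ i → + a * (+ h i * + c i)) (λ i → d * (+ b i * + c i)) ⟩
    ∑ℤ (λ i → + a * (+ h i * + c i)) + ∑ℤ (λ i → d * (+ b i * + c i))
      ≡⟨ cong₂ _+_ (∑ℤ-* (+ a) (λ i → + h i * + c i)) (∑ℤ-* d (λ i → + b i * + c i)) ⟩
    + a * ∑ℤ (λ i → + h i * + c i) + d * ∑ℤ (λ i → + b i * + c i)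
      ≡⟨ cong₂ (λ x y → + a * x + d * y) (pos-· h c) (pos-· b c) ⟨
    + a * + (h · c) + d * + (b · c)
      ∎
    where
    open ≡-Reasoning
    distribute : ∀ C H A D B → C * (H * A + D * B) ≡ A * (H * C) + D * (B * C)
    distribute = solve-∀
    termwise : ∀ i → + c i * gen a d b h i ≡ + a * (+ h i * + c i) + d * (+ b i * + c i)
    termwise i = trans (cong (λ x → + c i * (x + d * + b i)) (ℤP.pos-* (h i) a))
                       (distribute (+ c i) (+ h i) (+ a) d (+ b i))

  combination-expansion : ∀ c₀ c →
    + (c₀ ℕ.* a ℕ.+ c · g) ≡ + p * + ((c₀ ℕ.+ h · c) ℕ.* q) + d * + (b · c)
  combination-expansion c₀ c = begin
    + (c₀ ℕ.* a ℕ.+ c · g)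
      ≡⟨ trans (ℤP.pos-+ (c₀ ℕ.* a) (c · g)) (cong₂ _+_ (ℤP.pos-* c₀ a) (gen-combination c)) ⟩
    + c₀ * + a + (+ a * + (h · c) + d * + (b · c))
      ≡⟨ cong (λ x → + c₀ * x + (x * + (h · c) + d * + (b · c))) +a≡+q*+p ⟩
    + c₀ * (+ q * + p) + (+ q * + p * + (h · c) + d * + (b · c))
      ≡⟨ regroup (+ c₀) (+ q) (+ p) (+ (h · c)) d (+ (b · c)) ⟩
    + p * ((+ c₀ + + (h · c)) * + q) + d * + (b · c)
      ≡⟨ cong (λ x → + p * x + d * + (b · c)) cast ⟨
    + p * + ((c₀ ℕ.+ h · c) ℕ.* q) + d * + (b · c)
      ∎
    where
    open ≡-Reasoning
    regroup : ∀ C Q P H D B → C * (Q * P) + (Q * P * H + D * B) ≡ P * ((C + H) * Q) + D * B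
    regroup = solve-∀
    cast : + ((c₀ ℕ.+ h · c) ℕ.* q) ≡ (+ c₀ + + (h · c)) * + q
    cast = trans (ℤP.pos-* (c₀ ℕ.+ h · c) q) (cong (_* + q) (ℤP.pos-+ c₀ (h · c)))

  candidate : ℕ → ℕ → ℤ
  candidate v M = + (v ℕ.* q) + + M * d

  combination-candidate : ∀ c₀ c M → b · c ≡ M ℕ.* p →
                          + (c₀ ℕ.* a ℕ.+ c · g) ≡ + p * candidate (c₀ ℕ.+ h · c) M
  combination-candidate c₀ c M b·c≡ = begin
    + (c₀ ℕ.* a ℕ.+ c · g)      ≡⟨ combination-expansion c₀ c ⟩
    + p * + X + d * + (b · c)   ≡⟨ cong (λ x → + p * + X + d * x) (trans (cong +_ b·c≡) (ℤP.pos-* M p)) ⟩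
    + p * + X + d * (+ M * + p) ≡⟨ regroup (+ p) (+ X) d (+ M) ⟩
    + p * (+ X + + M * d)       ∎
    where
    open ≡-Reasoning
    X = (c₀ ℕ.+ h · c) ℕ.* q
    regroup : ∀ P X D M → P * X + D * (M * P) ≡ P * (X + M * D)
    regroup = solve-∀

  compose : ∀ x M → b · x ≡ M ℕ.* p → ∃ λ n → + n ≡ candidate (h · x) M × InQuot a d b h p n
  compose x M b·x≡ =
    let n , n≡ , pn≡ = exact-quotient p (candidate (h · x) M) (x · g)
                                      (sym (combination-candidate 0 x M b·x≡))
    in n , n≡ , Generated⇒InSG (0 , x , pn≡)

  p∣b·c : ∀ {n c₀ c} → p ℕ.* n ≡ c₀ ℕ.* a ℕ.+ c · g → p ∣ b · c
  p∣b·c {n} {c₀} {c} pn≡ = ℤS.∣⇒∣ᵤ (d-cancel p∣a (ℤS.divides (+ n - + X) (begin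
    d * + (b · c)                               ≡⟨ isolate (+ p) (+ X) (d * + (b · c)) ⟩
    + p * + X + d * + (b · c) - + p * + X       ≡⟨ cong (λ y → y - + p * + X) (combination-expansion c₀ c) ⟨
    + (c₀ ℕ.* a ℕ.+ c · g) - + p * + X          ≡⟨ cong (λ y → + y - + p * + X) pn≡ ⟨
    + (p ℕ.* n) - + p * + X                     ≡⟨ cong (λ y → y - + p * + X) (ℤP.pos-* p n) ⟩
    + p * + n - + p * + X                       ≡⟨ factor (+ p) (+ n) (+ X) ⟩
    (+ n - + X) * + p                           ∎)))
    where
    open ≡-Reasoning
    X = (c₀ ℕ.+ h · c) ℕ.* q
    isolate : ∀ P X E → E ≡ P * X + E - P * X
    isolate = solve-∀
    factor : ∀ P N X → P * N - P * X ≡ (N - X) * P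
    factor = solve-∀

  Decomposition : ℕ → Set
  Decomposition n = Σ ℕ λ c₀ → Σ (Fin k → ℕ) λ c → Σ ℕ λ M →
    b · c ≡ M ℕ.* p × + n ≡ candidate (c₀ ℕ.+ h · c) M

  decompose : ∀ {n} → InQuot a d b h p n → Decomposition n
  decompose {n} n∈ =
    let c₀ , c , pn≡ = InSG⇒Generated n∈
        divides M b·c≡ = p∣b·c {n} {c₀} {c} pn≡
    in c₀ , c , M , b·c≡ , ℤP.*-cancelˡ-≡ (+ p) (+ n) (candidate (c₀ ℕ.+ h · c) M) (begin
      + p * + n                        ≡⟨ ℤP.pos-* p n ⟨
      + (p ℕ.* n)                      ≡⟨ cong +_ pn≡ ⟩
      + (c₀ ℕ.* a ℕ.+ c · g)           ≡⟨ combination-candidate c₀ c M b·c≡ ⟩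
      + p * candidate (c₀ ℕ.+ h · c) M ∎)
    where open ≡-Reasoning

  class-index : ∀ {r n v M} → r ℕ.< q → + n ≡ candidate v M → CongMod q (d * + r) n →
                ∃ λ m → M ≡ m ℕ.* q ℕ.+ r
  class-index {r} {n} {v} {M} r<q n≡ n≡dr = residue-of-multiple r<q (d-cancel q∣a
    (subst (+ q ℤS.∣_) difference
      (ℤS.∣m∣n⇒∣m-n (ℤS.∣ᵤ⇒∣ {+ q} {+ n - d * + r} n≡dr) (ℤS.∣m⇒∣m*n (+ v) (ℤS.∣-refl {+ q})))))
    where
    open ≡-Reasoning
    regroup : ∀ V Q M D R → (V * Q + M * D - D * R) - Q * V ≡ D * (M - R)
    regroup = solve-∀
    difference : (+ n - d * + r) - + q * + v ≡ d * (+ M - + r)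
    difference = begin
      (+ n - d * + r) - + q * + v
        ≡⟨ cong (λ x → (x - d * + r) - + q * + v) (trans n≡ (cong (_+ + M * d) (ℤP.pos-* v q))) ⟩
      (+ v * + q + + M * d - d * + r) - + q * + v
        ≡⟨ regroup (+ v) (+ q) (+ M) d (+ r) ⟩
      d * (+ M - + r)
        ∎

  candidate-congruent : ∀ {n} v m r → + n ≡ candidate v (m ℕ.* q ℕ.+ r) → CongMod q (d * + r) n
  candidate-congruent {n} v m r n≡ = ℤS.∣⇒∣ᵤ (ℤS.divides (+ v + + m * d) (begin
    + n - d * + r
      ≡⟨ cong (_- d * + r) n≡ ⟩
    + (v ℕ.* q) + + (m ℕ.* q ℕ.+ r) * d - d * + r
      ≡⟨ cong₂ (λ x y → x + y * d - d * + r) (ℤP.pos-* v q)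
               (trans (ℤP.pos-+ (m ℕ.* q) r) (cong (_+ + r) (ℤP.pos-* m q))) ⟩
    + v * + q + (+ m * + q + + r) * d - d * + r
      ≡⟨ regroup (+ v) (+ q) (+ m) (+ r) d ⟩
    (+ v + + m * d) * + q
      ∎))
    where
    open ≡-Reasoning
    regroup : ∀ V Q M R D → V * Q + (M * Q + R) * D - D * R ≡ (V + M * D) * Q
    regroup = solve-∀

  candidate-mono : ∀ v v′ M → v ℕ.≤ v′ → candidate v M ≤ candidate v′ M
  candidate-mono v v′ M v≤v′ = ℤP.+-monoˡ-≤ (+ M * d) (ℤ.+≤+ (ℕP.*-monoˡ-≤ q v≤v′))

  candidate-cancel : ∀ v v′ M → candidate v M ≤ candidate v′ M → v ℕ.≤ v′
  candidate-cancel v v′ M le =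
    ℕP.≮⇒≥ λ v′<v → ℤP.<⇒≱ (ℤP.+-monoˡ-< (+ M * d) (ℤ.+<+ (ℕP.*-monoˡ-< q v′<v))) le

  class-size : ∀ m r → (m ℕ.* q ℕ.+ r) ℕ.* p ≡ m ℕ.* a ℕ.+ r ℕ.* p
  class-size m r = begin
    (m ℕ.* q ℕ.+ r) ℕ.* p       ≡⟨ distribute m q r p ⟩
    m ℕ.* (q ℕ.* p) ℕ.+ r ℕ.* p ≡⟨ cong (λ x → m ℕ.* x ℕ.+ r ℕ.* p) q*p≡a ⟩
    m ℕ.* a ℕ.+ r ℕ.* p         ∎
    where
    open ≡-Reasoning
    distribute : ∀ m q r p → (m ℕ.* q ℕ.+ r) ℕ.* p ≡ m ℕ.* (q ℕ.* p) ℕ.+ r ℕ.* p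
    distribute = ℕ-Solver.solve-∀

  in-class : ∀ {r} x m → b · x ≡ m ℕ.* a ℕ.+ r ℕ.* p →
             ∃ λ n → + n ≡ candidate (h · x) (m ℕ.* q ℕ.+ r) × InClass r n
  in-class {r} x m b·x≡ =
    let n , n≡ , n∈ = compose x (m ℕ.* q ℕ.+ r) (trans b·x≡ (sym (class-size m r)))
    in n , n≡ , n∈ , candidate-congruent (h · x) m r n≡

  least-below-candidates : ∀ {r N} → IsLeastℕ (InClass r) N →
    ∀ x m → b · x ≡ m ℕ.* a ℕ.+ r ℕ.* p → + N ≤ candidate (h · x) (m ℕ.* q ℕ.+ r)
  least-below-candidates {N = N} (_ , N≤) x m b·x≡ =
    let n , n≡ , n∈ = in-class x m b·x≡
    in subst (+ N ≤_) n≡ (ℤ.+≤+ (N≤ n n∈))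

  class-member : ∀ r c w → + (c · g) ≡ d * + r * + p + w * + a → ∃ (InClass r)
  class-member r c w c·g≡ = member (exact-quotient p z (c · g) pz≡c·g)
    where
    open ≡-Reasoning
    z = d * + r + w * + q
    regroup : ∀ P D R W Q → P * (D * R + W * Q) ≡ D * R * P + W * (Q * P)
    regroup = solve-∀
    cancel : ∀ X Y → X + Y - X ≡ Y
    cancel = solve-∀
    pz≡c·g : + p * z ≡ + (c · g)
    pz≡c·g = begin
      + p * (d * + r + w * + q)        ≡⟨ regroup (+ p) d (+ r) w (+ q) ⟩
      d * + r * + p + w * (+ q * + p)  ≡⟨ cong (λ x → d * + r * + p + w * x) +a≡+q*+p ⟨
      d * + r * + p + w * + a          ≡⟨ c·g≡ ⟨
      + (c · g)                        ∎
    member : (∃ λ n → + n ≡ z × p ℕ.* n ≡ c · g) → ∃ (InClass r)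
    member (n , n≡ , pn≡) = n , Generated⇒InSG (0 , c , pn≡) , ℤS.∣⇒∣ᵤ (ℤS.divides w (begin
      + n - d * + r                    ≡⟨ cong (_- d * + r) n≡ ⟩
      d * + r + w * + q - d * + r      ≡⟨ cancel (d * + r) (w * + q) ⟩
      w * + q                          ∎))

  class-inhabited : ∀ r → ∃ (InClass r)
  class-inhabited r =
    let e , e∣a , e∣g , u₀ , u , e≡ = common-divisor-combination a g
        c , w , c·g≡ = combination-residue a g u₀ u (trans (cong +_ (sym (gcd≡1 e e∣a e∣g))) e≡)
                                           (d * + r * + p)
    in class-member r c w c·g≡

  ClassDecomposition : ℕ → ℕ → Set
  ClassDecomposition r n = Σ ℕ λ c₀ → Σ (Fin k → ℕ) λ c → Σ ℕ λ m →
    b · c ≡ m ℕ.* a ℕ.+ r ℕ.* p × + n ≡ candidate (c₀ ℕ.+ h · c) (m ℕ.* q ℕ.+ r)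

  decompose-class : ∀ {r n} → r ℕ.< q → InClass r n → ClassDecomposition r n
  decompose-class {r} {n} r<q (n∈ , n≡dr) = from-decomposition (decompose n∈)
    where
    from-decomposition : Decomposition n → ClassDecomposition r n
    from-decomposition (c₀ , c , M , b·c≡Mp , n≡) =
      from-index (class-index {v = c₀ ℕ.+ h · c} r<q n≡ n≡dr)
      where
      from-index : ∃ (λ m → M ≡ m ℕ.* q ℕ.+ r) → ClassDecomposition r n
      from-index (m , refl) = c₀ , c , m , trans b·c≡Mp (class-size m r) , n≡

  -- Minimality of N forces c₀ = 0 and makes c attain O(ma + rp): a cheaper x would give a smaller
  -- element of the class.
  least-in-RHSSet : ∀ {r N} → IsLeastℕ (InClass r) N → ClassDecomposition r N →
                    RHSSet a d b h p q r (+ N)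
  least-in-RHSSet {r} {N} least (c₀ , c , m , b·c≡ , N≡) = m , h · c , O-c , N≡candidate
    where
    M = m ℕ.* q ℕ.+ r
    O-c : IsO b h (m ℕ.* a ℕ.+ r ℕ.* p) (h · c)
    O-c = (c , b·c≡ , refl) , λ where
      v (x , b·x≡ , refl) → ℕP.≤-trans (ℕP.m≤n+m (h · c) c₀) (candidate-cancel (c₀ ℕ.+ h · c) (h · x) M
        (subst (_≤ candidate (h · x) M) N≡ (least-below-candidates least x m b·x≡)))
    N≡candidate : + N ≡ candidate (h · c) M
    N≡candidate = ℤP.≤-antisym (least-below-candidates least c m b·c≡)
      (subst (candidate (h · c) M ≤_) (sym N≡)
        (candidate-mono (h · c) (c₀ ℕ.+ h · c) M (ℕP.m≤n+m (h · c) c₀)))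

  least-below-RHSSet : ∀ {r N} → IsLeastℕ (InClass r) N → ∀ z → RHSSet a d b h p q r z → + N ≤ z
  least-below-RHSSet least z (m , v , ((x , b·x≡ , refl) , _) , refl) =
    least-below-candidates least x m b·x≡

  N-formula : ∀ r → r ℕ.< q →
              Σ ℕ λ N → IsN a d b h p q r N × IsLeastℤ (RHSSet a d b h p q r) (+ N)
  N-formula r r<q = from-least (least-exists (InClass? r) (proj₂ (class-inhabited r)))
    where
    from-least : Σ ℕ (IsLeastℕ (InClass r)) →
                 Σ ℕ λ N → IsN a d b h p q r N × IsLeastℤ (RHSSet a d b h p q r) (+ N)
    from-least (N , least) =
      N , least , least-in-RHSSet least (decompose-class r<q (proj₁ least)) , least-below-RHSSet least

  InQuot-+q : ∀ {n} j → InQuot a d b h p n → InQuot a d b h p (n ℕ.+ j ℕ.* q)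
  InQuot-+q {n} j n∈ =
    let c₀ , c , pn≡ = InSG⇒Generated n∈
    in Generated⇒InSG (c₀ ℕ.+ j , c , (begin
         p ℕ.* (n ℕ.+ j ℕ.* q)            ≡⟨ distribute p n j q ⟩
         p ℕ.* n ℕ.+ j ℕ.* (q ℕ.* p)      ≡⟨ cong₂ (λ x y → x ℕ.+ j ℕ.* y) pn≡ q*p≡a ⟩
         c₀ ℕ.* a ℕ.+ c · g ℕ.+ j ℕ.* a   ≡⟨ regroup c₀ a (c · g) j ⟩
         (c₀ ℕ.+ j) ℕ.* a ℕ.+ c · g       ∎))
    where
    open ≡-Reasoning
    distribute : ∀ p n j q → p ℕ.* (n ℕ.+ j ℕ.* q) ≡ p ℕ.* n ℕ.+ j ℕ.* (q ℕ.* p)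
    distribute = ℕ-Solver.solve-∀
    regroup : ∀ c₀ a C j → c₀ ℕ.* a ℕ.+ C ℕ.+ j ℕ.* a ≡ (c₀ ℕ.+ j) ℕ.* a ℕ.+ C
    regroup = ℕ-Solver.solve-∀

  step-down : ∀ {r m s} → InClass r m → CongMod q (d * + r) s → m ℕ.< s →
              ∃ λ t → InQuot a d b h p t × s ≡ t ℕ.+ q
  step-down {r} {m} {s} (m∈ , m≡dr) s≡dr m<s =
    descend (congruent-gap {q} {d * + r} m≡dr s≡dr (ℕP.<⇒≤ m<s))
    where
    regroup : ∀ m q x → m ℕ.+ (q ℕ.+ x) ≡ m ℕ.+ x ℕ.+ q
    regroup = ℕ-Solver.solve-∀
    descend : (∃ λ j → s ≡ m ℕ.+ j ℕ.* q) → ∃ λ t → InQuot a d b h p t × s ≡ t ℕ.+ q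
    descend (zero , s≡m+0) = ⊥-elim (ℕP.<-irrefl (trans (sym (ℕP.+-identityʳ m)) (sym s≡m+0)) m<s)
    descend (suc j , s≡) = m ℕ.+ j ℕ.* q , InQuot-+q j m∈ , trans s≡ (regroup m q (j ℕ.* q))

  apery-set : ∀ s → InApery a d b h p q s ⇔ ∃ λ r → r ℕ.< q × IsN a d b h p q r s
  apery-set s = mk⇔ to from
    where
    to : InApery a d b h p q s → ∃ λ r → r ℕ.< q × IsN a d b h p q r s
    to (s∈ , s-q∉) =
      let r , r<q , s≡dr = residue s
      in r , r<q , (s∈ , s≡dr) , λ m m∈ → ℕP.≮⇒≥ (s-q∉ ∘ step-down m∈ s≡dr)
    from : (∃ λ r → r ℕ.< q × IsN a d b h p q r s) → InApery a d b h p q s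
    from (r , _ , (s∈ , s≡dr) , minimal) = s∈ , λ where
      (t , t∈ , refl) → ℕP.<⇒≱ (ℕP.m<m+n t (ℕ.>-nonZero⁻¹ q))
                                (minimal t (t∈ , CongMod-+q⇒CongMod {q} {d * + r} {t} s≡dr))

lemma2p2 : (k a : ℕ) (d : ℤ) (b h : Fin k → ℕ) (p : ℕ) .{{_ : NonZero p}} →
    1 ℕ.≤ k → 2 ℕ.≤ a → d ≢ + 0 →
    (∀ i → 0 ℕ.< b i) → (∀ i → 0 ℕ.< h i) →
    GcdOne a d b h →
    (d ℤ.< + 0 → ∀ i → + 1 ℤ.< gen a d b h i) →
    p ∣ a →
    (∀ r → r ℕ.< a / p →
      Σ ℕ λ N → IsN a d b h p (a / p) r N × IsLeastℤ (RHSSet a d b h p (a / p) r) (+ N))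
    × (∀ s → InApery a d b h p (a / p) s ⇔ Σ ℕ λ r → r ℕ.< a / p × IsN a d b h p (a / p) r s)
lemma2p2 k a d b h p _ 2≤a d≢0 b>0 _ gcd≡1 d<0⇒gen>1 p∣a = N-formula , apery-set
  where
  instance
    a≢0 : NonZero a
    a≢0 = ℕ.>-nonZero (ℕP.≤-trans (s≤s z≤n) 2≤a)
  open QuotientSemigroup a d b h p p∣a (gen-positive {a = a} {h = h} d≢0 b>0 d<0⇒gen>1) gcd≡1
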